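{- (1) There is no $\mathrm{TS}(6,2)$ admitting a zero-sum $3$-flow, but there is a $\mathrm{TS}(6,2)$ admitting a zero-sum $4$-flow. (2) There exists a $\mathrm{TS}(6,4)$ with a zero-sum $2$-flow. (3) There exists a $\mathrm{TS}(6,6)$ with a zero-sum $3$-flow.
   Context: A $\mathrm{TS}(v,\lambda)$ (triple system) is a pair $(X,\mathcal B)$ where $X$ is a set of $v$ points and $\mathcal B$ is a collection (multiset) of $3$-subsets of $X$, called blocks, such that every $2$-subset of $X$ is contained in exactly $\lambda$ blocks. For a positive integer $n$, a zero-sum $n$-flow of such a design is a map $f:\mathcal B\to\{\pm1,\dots,\pm(n-1)\}$ such that for every point $x\in X$, $\sum_{B\ni x} f(B)=0$. -}

module Defs where

open import Data.Nat using (ℕ; zero; suc; _<_)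
open import Data.Fin using (Fin) renaming (_<_ to _<ᶠ_; _≟_ to _≟ᶠ_)
open import Data.Fin.Base using (toℕ)
open import Data.Bool using (Bool; true; false; if_then_else_; _∨_; _∧_)
open import Data.Integer using (ℤ; 0ℤ; ∣_∣) renaming (_+_ to _+ℤ_)
open import Data.List using (List; length; lookup; allFin; map; foldr)
open import Data.Nat.ListAction using (sum)
open import Data.Product using (Σ; _×_; _,_; ∃)
open import Relation.Nullary.Decidable using (⌊_⌋)
open import Relation.Binary.PropositionalEquality using (_≡_; _≢_)

-- A block is a 3-subset {a,b,c} of the point set Fin v, represented
-- canonically as a strictly increasing triple a < b < c.
Block : ℕ → Set
Block v = Σ (Fin v × Fin v × Fin v) λ { (a , b , c) → (a <ᶠ b) × (b <ᶠ c) }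

_∈ᵇ_ : ∀ {v} → Fin v → Block v → Bool
x ∈ᵇ ((a , b , c) , _) = ⌊ x ≟ᶠ a ⌋ ∨ ⌊ x ≟ᶠ b ⌋ ∨ ⌊ x ≟ᶠ c ⌋

pairCount : ∀ {v} → Fin v → Fin v → List (Block v) → ℕ
pairCount x y ℬ = sum (map (λ B → if (x ∈ᵇ B) ∧ (y ∈ᵇ B) then 1 else 0) ℬ)

-- (Fin v, ℬ) is a TS(v, λ): every 2-subset {x,y} lies in exactly λ blocks.
-- The block collection is a multiset, represented as a list.
IsTS : (v λ' : ℕ) → List (Block v) → Set
IsTS v λ' ℬ = ∀ (x y : Fin v) → x ≢ y → pairCount x y ℬ ≡ λ'

sumℤ : ∀ {m} → (Fin m → ℤ) → ℤ
sumℤ {m} g = foldr _+ℤ_ 0ℤ (map g (allFin m))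

IsZeroSumFlow : ∀ {v} (n : ℕ) (ℬ : List (Block v)) → (Fin (length ℬ) → ℤ) → Set
IsZeroSumFlow {v} n ℬ f =
  (∀ i → (0 < ∣ f i ∣) × (∣ f i ∣ < n)) ×
  (∀ (x : Fin v) → sumℤ (λ i → if x ∈ᵇ lookup ℬ i then f i else 0ℤ) ≡ 0ℤ)

HasZeroSumFlow : ∀ {v} (n : ℕ) → List (Block v) → Set
HasZeroSumFlow n ℬ = ∃ λ f → IsZeroSumFlow n ℬ f

-- Reducing a zero-sum 3-flow modulo 3 turns every flow value into a residue w ∈ {1, 2}, and
-- at each point the residues of the blocks through it sum to a multiple of 3.  Grouping the
-- blocks of a TS(6,2) by their underlying triple, every one of the 20 triples carries a
-- multiplicity n ≤ 2 and a total residue w with n ≤ w ≤ 2n, i.e. one of six options.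
-- Choosing the options triple by triple, in lexicographic order, and rejecting a partial
-- choice as soon as a pair lies in more than two blocks, or a pair or point through which
-- no later triple passes fails its final condition, the search dies out: no TS(6,2) has a
-- zero-sum 3-flow.
--
-- The designs of the existence parts are one, two and three copies of a TS(6,2).  On two or
-- three copies the flow is constant on each copy, with constants summing to 0; it is zero-sum
-- because every point lies on five blocks of each copy.
module Submission where

open import Defs

open import Algebra.Properties.CommutativeSemigroup using (x∙yz≈y∙xz)
open import Data.Bool using (Bool; true; false; T; T?; not; _∧_; if_then_else_)
open import Data.Bool.ListAction using (any)
open import Data.Bool.Properties using (T-∧; T-≡; T-not-≡; ∨-zeroʳ; if-float)
open import Data.Empty using (⊥-elim)
open import Data.Fin using (Fin; _≟_; #_) renaming (_<?_ to _<ᶠ?_)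
open import Data.Fin.Properties using (<-irrelevant; <⇒≢; <-trans; all?)
open import Data.Integer
  using (ℤ; +_; -[1+_]; 0ℤ; ∣_∣; -_; _-_; _*_; _%ℕ_; _/ℕ_) renaming (_+_ to _+ᶻ_; _≟_ to _≟ᶻ_)
open import Data.Integer.DivMod using (a≡a%ℕn+[a/ℕn]*n)
open import Data.Integer.Divisibility.Signed
  using (divides; ∣m∣n⇒∣m+n; ∣m⇒∣-m; ∣⇒∣ᵤ) renaming (_∣_ to _∣ᶻ_)
import Data.Integer.Properties as ℤ
open import Data.Integer.Solver using (module +-*-Solver)
open import Data.List
  using (List; []; _∷_; map; foldr; tabulate; filter; allFin; cartesianProduct; mapMaybe; _++_; replicate; lookup;
         length)
open import Data.List.Membership.Propositional using (_∈_; lose)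
open import Data.List.Membership.Propositional.Properties using (∈-allFin; ∈-cartesianProduct⁺)
open import Data.List.Properties using (map-∘; map-tabulate; tabulate-lookup; tabulate-cong)
open import Data.List.Relation.Unary.All as All using (All; []; _∷_)
open import Data.List.Relation.Unary.All.Properties using (all-filter; filter⁺; tabulate⁺)
open import Data.List.Relation.Unary.Any using (here; there)
open import Data.List.Relation.Unary.Any.Properties using (map⁺; mapMaybe⁺; any⁺)
open import Data.Maybe using (Maybe; just; nothing)
import Data.Maybe.Relation.Unary.Any as Maybe
open import Data.Nat using (ℕ; suc; _+_; _≤_; _<_; _<?_; z≤n; s≤s; NonZero)
open import Data.Nat.Divisibility using (_∣_; _∣?_)
open import Data.Nat.ListAction using (sum)
open import Data.Nat.Properties
  using (m≤m+n; m≤n+m; ≤-trans; +-identityʳ; +-mono-≤; +-suc; +-assoc; +-commutativeSemigroup; _≤?_)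
  renaming (_≟_ to _≟ℕ_)
open import Data.Product using (_×_; ∃; _,_; proj₁; proj₂)
open import Data.Product.Properties using (≡-dec)
open import Data.Unit using (tt)
open import Function using (id; case_of_)
open import Function.Bundles using (Equivalence)
open import Data.Vec as Vec using (Vec)
open import Data.Vec.Properties using (lookup∘tabulate; lookup-replicate)
open import Relation.Binary.Definitions using (DecidableEquality)
open import Relation.Binary.PropositionalEquality
  using (_≡_; _≢_; refl; cong; cong₂; sym; subst; trans; module ≡-Reasoning)
open import Relation.Nullary using (¬_)
open import Relation.Nullary.Decidable
  using (Dec; yes; no; map′; ¬?; does; ⌊_⌋; dec-true; isYes≗does; _→-dec_; _×-dec_; True; fromWitness; toWitness;
         from-yes)

module _ {v : ℕ} where

  proj₁-injective : {B C : Block v} → proj₁ B ≡ proj₁ C → B ≡ C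
  proj₁-injective {_ , p , q} {_ , p′ , q′} refl rewrite <-irrelevant p p′ | <-irrelevant q q′ = refl

  _≟ᵇ_ : DecidableEquality (Block v)
  B ≟ᵇ C = map′ proj₁-injective (cong proj₁) (≡-dec _≟_ (≡-dec _≟_ _≟_) (proj₁ B) (proj₁ C))

  toBlock : Fin v × Fin v × Fin v → Maybe (Block v)
  toBlock (a , b , c) with a <ᶠ? b | b <ᶠ? c
  ... | yes a<b | yes b<c = just ((a , b , c) , a<b , b<c)
  ... | _       | _       = nothing

allBlocks : ∀ v → List (Block v)
allBlocks v = mapMaybe toBlock (cartesianProduct (allFin v) (cartesianProduct (allFin v) (allFin v)))

∈-allBlocks : ∀ {v} (B : Block v) → B ∈ allBlocks v
∈-allBlocks B@((a , b , c) , a<b , b<c) =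
  mapMaybe⁺ toBlock _ (map⁺ (lose (∈-cartesianProduct⁺ (∈-allFin a) b-c∈pairs) toBlock-triple))
  where
  b-c∈pairs : (b , c) ∈ cartesianProduct (allFin _) (allFin _)
  b-c∈pairs = ∈-cartesianProduct⁺ (∈-allFin b) (∈-allFin c)
  toBlock-triple : Maybe.Any (B ≡_) (toBlock (a , b , c))
  toBlock-triple with a <ᶠ? b | b <ᶠ? c
  ... | yes _  | yes _  = Maybe.just (proj₁-injective refl)
  ... | no a≮b | _      = ⊥-elim (a≮b a<b)
  ... | yes _  | no b≮c = ⊥-elim (b≮c b<c)

sumᶻ : List ℤ → ℤ
sumᶻ = foldr _+ᶻ_ 0ℤ

module _ (d : ℕ) .{{_ : NonZero d}} where
  open +-*-Solver

  ∣-%ℕ : ∀ z → + d ∣ᶻ z - + (z %ℕ d)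
  ∣-%ℕ z = divides (z /ℕ d) (begin
    z - + r
      ≡⟨ cong (_- + r) (a≡a%ℕn+[a/ℕn]*n z d) ⟩
    (+ r +ᶻ z /ℕ d * + d) - + r
      ≡⟨ solve 3 (λ r q k → (r :+ q :* k) :- r := q :* k) refl (+ r) (z /ℕ d) (+ d) ⟩
    z /ℕ d * + d
      ∎)
    where
    open ≡-Reasoning
    r = z %ℕ d

  sumᶻ-∣-%ℕ : ∀ zs → + d ∣ᶻ sumᶻ zs - + sum (map (_%ℕ d) zs)
  sumᶻ-∣-%ℕ []       = divides 0ℤ refl
  sumᶻ-∣-%ℕ (z ∷ zs) = subst (+ d ∣ᶻ_) regroup (∣m∣n⇒∣m+n (∣-%ℕ z) (sumᶻ-∣-%ℕ zs))
    where
    r = z %ℕ d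
    s = sum (map (_%ℕ d) zs)
    regroup : (z - + r) +ᶻ (sumᶻ zs - + s) ≡ (z +ᶻ sumᶻ zs) - + (r + s)
    regroup = trans (solve 4 (λ z S r s → (z :- r) :+ (S :- s) := (z :+ S) :- (r :+ s)) refl
                           z (sumᶻ zs) (+ r) (+ s))
                    (cong (λ n → (z +ᶻ sumᶻ zs) - n) (sym (ℤ.pos-+ r s)))

  zero-sum⇒∣sum-%ℕ : ∀ zs → sumᶻ zs ≡ 0ℤ → d ∣ sum (map (_%ℕ d) zs)
  zero-sum⇒∣sum-%ℕ zs Σzs≡0 = ∣⇒∣ᵤ (subst (+ d ∣ᶻ_) -[0-s]≡s (∣m⇒∣-m d∣0-s))
    where
    s = sum (map (_%ℕ d) zs)
    d∣0-s : + d ∣ᶻ 0ℤ - + s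
    d∣0-s = subst (λ z → + d ∣ᶻ z - + s) Σzs≡0 (sumᶻ-∣-%ℕ zs)
    -[0-s]≡s : - (0ℤ - + s) ≡ + s
    -[0-s]≡s = trans (cong -_ (ℤ.+-identityˡ (- + s))) (ℤ.neg-involutive (+ s))

%ℕ3-bounds : ∀ z → 0 < ∣ z ∣ → ∣ z ∣ < 3 → 1 ≤ z %ℕ 3 × z %ℕ 3 ≤ 2
%ℕ3-bounds (+ 1)                 _  _ = s≤s z≤n , s≤s z≤n
%ℕ3-bounds (+ 2)                 _  _ = s≤s z≤n , s≤s (s≤s z≤n)
%ℕ3-bounds -[1+ 0 ]              _  _ = s≤s z≤n , s≤s (s≤s z≤n)
%ℕ3-bounds -[1+ 1 ]              _  _ = s≤s z≤n , s≤s z≤n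
%ℕ3-bounds (+ 0)                 () _
%ℕ3-bounds (+ suc (suc (suc _))) _  (s≤s (s≤s (s≤s ())))
%ℕ3-bounds -[1+ suc (suc _) ]    _  (s≤s (s≤s (s≤s ())))

sum-map-filter : ∀ {A : Set} {P : A → Set} (P? : ∀ a → Dec (P a)) (h : A → ℕ) xs →
                 sum (map h xs) ≡ sum (map h (filter P? xs)) + sum (map h (filter (λ a → ¬? (P? a)) xs))
sum-map-filter P? h []       = refl
sum-map-filter P? h (x ∷ xs) with does (P? x)
... | true  = trans (cong (λ n → h x + n) (sum-map-filter P? h xs)) (sym (+-assoc (h x) _ _))
... | false = trans (cong (λ n → h x + n) (sum-map-filter P? h xs))
                    (x∙yz≈y∙xz +-commutativeSemigroup (h x) (sum (map h (filter P? xs))) _)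

WBlock : ℕ → Set
WBlock v = Block v × ℕ

module _ {v : ℕ} where

  pairIn : Fin v → Fin v → Block v → Bool
  pairIn x y B = (x ∈ᵇ B) ∧ (y ∈ᵇ B)

  count : (Block v → Bool) → (WBlock v → ℕ) → List (WBlock v) → ℕ
  count p g R = sum (map (λ e → if p (proj₁ e) then g e else 0) R)

  copiesOf : Block v → List (WBlock v) → List (WBlock v)
  copiesOf B = filter (λ e → proj₁ e ≟ᵇ B)

  othersThan : Block v → List (WBlock v) → List (WBlock v)
  othersThan B = filter (λ e → ¬? (proj₁ e ≟ᵇ B))

  multiplicity : Block v → List (WBlock v) → ℕ
  multiplicity B R = sum (map (λ _ → 1) (copiesOf B R))

  weightOfCopies : Block v → List (WBlock v) → ℕ
  weightOfCopies B R = sum (map proj₂ (copiesOf B R))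

  count-copies : (p : Block v → Bool) (g : WBlock v → ℕ) {B : Block v} (Y : List (WBlock v)) →
                 All (λ e → proj₁ e ≡ B) Y → count p g Y ≡ (if p B then sum (map g Y) else 0)
  count-copies p g {B} []      []   with p B
  ... | true  = refl
  ... | false = refl
  count-copies p g (e ∷ Y) (refl ∷ Y≡B) rewrite count-copies p g Y Y≡B with p (proj₁ e)
  ... | true  = refl
  ... | false = refl

  count-regroup : (p : Block v → Bool) (g : WBlock v → ℕ) (B : Block v) (R : List (WBlock v)) →
                  count p g R ≡ (if p B then sum (map g (copiesOf B R)) else 0) + count p g (othersThan B R)
  count-regroup p g B R = trans (sum-map-filter (λ e → proj₁ e ≟ᵇ B) _ R)
    (cong (_+ count p g (othersThan B R)) (count-copies p g (copiesOf B R) (all-filter (λ e → proj₁ e ≟ᵇ B) R)))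

  +-count-regroup : (p : Block v → Bool) (g : WBlock v → ℕ) (B : Block v) (R : List (WBlock v)) (a : ℕ) →
                    (a + (if p B then sum (map g (copiesOf B R)) else 0)) + count p g (othersThan B R) ≡ a + count p g R
  +-count-regroup p g B R a = trans (+-assoc a _ _) (cong (λ n → a + n) (sym (count-regroup p g B R)))

  count-copies≤ : (p : Block v → Bool) (g : WBlock v → ℕ) (B : Block v) (R : List (WBlock v)) →
                  T (p B) → sum (map g (copiesOf B R)) ≤ count p g R
  count-copies≤ p g B R pB rewrite count-regroup p g B R | Equivalence.to T-≡ pB = m≤m+n _ _

record Tally (v : ℕ) : Set where
  constructor tally
  field
    pairTally  : Vec (Vec ℕ v) v
    pointTally : Vec ℕ v

module _ {v : ℕ} where

  pairsOf : Tally v → Fin v → Fin v → ℕ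
  pairsOf t x y = Vec.lookup (Vec.lookup (Tally.pairTally t) x) y

  weightOf : Tally v → Fin v → ℕ
  weightOf t x = Vec.lookup (Tally.pointTally t) x

  emptyTally : Tally v
  emptyTally = tally (Vec.replicate v (Vec.replicate v 0)) (Vec.replicate v 0)

  addCopies : Block v → ℕ → ℕ → Tally v → Tally v
  addCopies B n w t = tally
    (Vec.tabulate λ x → Vec.tabulate λ y → pairsOf t x y + (if pairIn x y B then n else 0))
    (Vec.tabulate λ x → weightOf t x + (if x ∈ᵇ B then w else 0))

  pairsOf-empty : ∀ x y → pairsOf emptyTally x y ≡ 0
  pairsOf-empty x y = trans (cong (λ row → Vec.lookup row y) (lookup-replicate x _)) (lookup-replicate y 0)

  weightOf-empty : ∀ x → weightOf emptyTally x ≡ 0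
  weightOf-empty x = lookup-replicate x 0

  pairsOf-addCopies : ∀ B n w t x y →
                      pairsOf (addCopies B n w t) x y ≡ pairsOf t x y + (if pairIn x y B then n else 0)
  pairsOf-addCopies B n w t x y =
    trans (cong (λ row → Vec.lookup row y) (lookup∘tabulate _ x)) (lookup∘tabulate _ y)

  weightOf-addCopies : ∀ B n w t x →
                       weightOf (addCopies B n w t) x ≡ weightOf t x + (if x ∈ᵇ B then w else 0)
  weightOf-addCopies B n w t x = lookup∘tabulate _ x

  Completes : Tally v → List (WBlock v) → Set
  Completes t R = (∀ x y → x ≢ y → pairsOf t x y + count (pairIn x y) (λ _ → 1) R ≡ 2)
                × (∀ x → 3 ∣ weightOf t x + count (x ∈ᵇ_) proj₂ R)

  completes-othersThan : ∀ B R t → Completes t R →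
                         Completes (addCopies B (multiplicity B R) (weightOfCopies B R) t) (othersThan B R)
  completes-othersThan B R t (pairs , points) = pairs′ , points′
    where
    n = multiplicity B R
    w = weightOfCopies B R
    N = othersThan B R
    pairs′ : ∀ x y → x ≢ y → pairsOf (addCopies B n w t) x y + count (pairIn x y) (λ _ → 1) N ≡ 2
    pairs′ x y x≢y = begin
      pairsOf (addCopies B n w t) x y + count (pairIn x y) (λ _ → 1) N
        ≡⟨ cong (_+ count (pairIn x y) (λ _ → 1) N) (pairsOf-addCopies B n w t x y) ⟩
      (pairsOf t x y + (if pairIn x y B then n else 0)) + count (pairIn x y) (λ _ → 1) N
        ≡⟨ +-count-regroup (pairIn x y) (λ _ → 1) B R (pairsOf t x y) ⟩
      pairsOf t x y + count (pairIn x y) (λ _ → 1) R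
        ≡⟨ pairs x y x≢y ⟩
      2 ∎
      where open ≡-Reasoning
    points′ : ∀ x → 3 ∣ weightOf (addCopies B n w t) x + count (x ∈ᵇ_) proj₂ N
    points′ x = subst (3 ∣_) (sym (begin
      weightOf (addCopies B n w t) x + count (x ∈ᵇ_) proj₂ N
        ≡⟨ cong (_+ count (x ∈ᵇ_) proj₂ N) (weightOf-addCopies B n w t x) ⟩
      (weightOf t x + (if x ∈ᵇ B then w else 0)) + count (x ∈ᵇ_) proj₂ N
        ≡⟨ +-count-regroup (x ∈ᵇ_) proj₂ B R (weightOf t x) ⟩
      weightOf t x + count (x ∈ᵇ_) proj₂ R ∎)) (points x)
      where open ≡-Reasoning

  spans-pair : (B : Block v) → ∃ λ ((a , b) : Fin v × Fin v) → a ≢ b × T (pairIn a b B)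
  spans-pair B@((a , b , c) , a<b , _) = (a , b) , <⇒≢ a<b , a-b∈B
    where
    a-b∈B : T (pairIn a b B)
    a-b∈B rewrite isYes≗does (a ≟ a) | dec-true (a ≟ a) refl
                | isYes≗does (b ≟ b) | dec-true (b ≟ b) refl | ∨-zeroʳ ⌊ b ≟ a ⌋ = tt

  multiplicity≤2 : ∀ B R t → Completes t R → multiplicity B R ≤ 2
  multiplicity≤2 B R t (pairs , _) with spans-pair B
  ... | (a , b) , a≢b , a-b∈B =
    ≤-trans (count-copies≤ (pairIn a b) (λ _ → 1) B R a-b∈B)
            (subst (count (pairIn a b) (λ _ → 1) R ≤_) (pairs a b a≢b) (m≤n+m _ (pairsOf t a b)))

  ResidueWeight : WBlock v → Set
  ResidueWeight e = 1 ≤ proj₂ e × proj₂ e ≤ 2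

  weight-bounds : ∀ Y → All ResidueWeight Y →
                  let n = sum (map (λ _ → 1) Y) in n ≤ sum (map proj₂ Y) × sum (map proj₂ Y) ≤ n + n
  weight-bounds []      []                = z≤n , z≤n
  weight-bounds (e ∷ Y) ((1≤w , w≤2) ∷ Y-weights) with weight-bounds Y Y-weights
  ... | n≤W , W≤2n = +-mono-≤ 1≤w n≤W
                   , subst (proj₂ e + sum (map proj₂ Y) ≤_) (cong suc (sym (+-suc n n))) (+-mono-≤ w≤2 W≤2n)
    where n = sum (map (λ _ → 1) Y)

  Misses : List (Block v) → (Block v → Bool) → Set
  Misses ks p = All (λ C → T (not (p C))) ks

  edges : Block v → List (Fin v × Fin v)
  edges ((a , b , c) , _) = (a , b) ∷ (a , c) ∷ (b , c) ∷ []

  corners : Block v → List (Fin v)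
  corners ((a , b , c) , _) = a ∷ b ∷ c ∷ []

  edges-distinct : (B : Block v) → All (λ (x , y) → x ≢ y) (edges B)
  edges-distinct (_ , a<b , b<c) = <⇒≢ a<b ∷ <⇒≢ (<-trans a<b b<c) ∷ <⇒≢ b<c ∷ []

  -- Adding copies of B only changes the pairs and points of B; a pair or point must already
  -- have its final value once no block of ks passes through it.
  Viable : Block v → List (Block v) → Tally v → Set
  Viable B ks t =
      All (λ (x , y) → pairsOf t x y ≤ 2 × (Misses ks (pairIn x y) → pairsOf t x y ≡ 2)) (edges B)
    × All (λ x → Misses ks (x ∈ᵇ_) → 3 ∣ weightOf t x) (corners B)

  viable? : ∀ B ks t → Dec (Viable B ks t)
  viable? B ks t =
          All.all? (λ (x , y) → pairsOf t x y ≤? 2 ×-dec (misses? (pairIn x y) →-dec pairsOf t x y ≟ℕ 2))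
                   (edges B)
    ×-dec All.all? (λ x → misses? (x ∈ᵇ_) →-dec 3 ∣? weightOf t x) (corners B)
    where
    misses? : ∀ p → Dec (Misses ks p)
    misses? p = All.all? (λ C → T? (not (p C))) ks

options : List (ℕ × ℕ)
options = (0 , 0) ∷ (1 , 1) ∷ (1 , 2) ∷ (2 , 2) ∷ (2 , 3) ∷ (2 , 4) ∷ []

∈-options : ∀ {n w} → n ≤ 2 → n ≤ w → w ≤ n + n → (n , w) ∈ options
∈-options {0} {0}       _ _ _ = here refl
∈-options {1} {1}       _ _ _ = there (here refl)
∈-options {1} {2}       _ _ _ = there (there (here refl))
∈-options {2} {2}       _ _ _ = there (there (there (here refl)))
∈-options {2} {3}       _ _ _ = there (there (there (there (here refl))))
∈-options {2} {4}       _ _ _ = there (there (there (there (there (here refl)))))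
∈-options {0} {suc _}   _ _ ()
∈-options {1} {0}       _ () _
∈-options {1} {suc (suc (suc _))} _ _ (s≤s (s≤s ()))
∈-options {2} {0}       _ () _
∈-options {2} {1}       _ (s≤s ()) _
∈-options {2} {suc (suc (suc (suc (suc _))))} _ _ (s≤s (s≤s (s≤s (s≤s ()))))
∈-options {suc (suc (suc _))} (s≤s (s≤s ())) _ _

tryCopies : ∀ {v} → (Tally v → Bool) → Block v → List (Block v) → Tally v → ℕ × ℕ → Bool
tryCopies next B ks t (n , w) = ⌊ viable? B ks (addCopies B n w t) ⌋ ∧ next (addCopies B n w t)

search : ∀ {v} → List (Block v) → Tally v → Bool
search []       t = true
search (B ∷ ks) t = any (tryCopies (search ks) B ks t) options

module _ {v : ℕ} where

  Covered : List (Block v) → List (WBlock v) → Set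
  Covered ks R = All (λ e → proj₁ e ∈ ks) R

  covered-othersThan : ∀ {B ks} R → Covered (B ∷ ks) R → Covered ks (othersThan B R)
  covered-othersThan {B} {ks} R cov =
    All.zipWith (λ {e} → skip-B {e})
                (filter⁺ (λ e → ¬? (proj₁ e ≟ᵇ B)) cov , all-filter (λ e → ¬? (proj₁ e ≟ᵇ B)) R)
    where
    skip-B : ∀ {e : WBlock v} → proj₁ e ∈ B ∷ ks × proj₁ e ≢ B → proj₁ e ∈ ks
    skip-B (here e≡B   , e≢B) = ⊥-elim (e≢B e≡B)
    skip-B (there e∈ks , _)   = e∈ks

  +-count-missed : ∀ {ks} p g R a → Covered ks R → Misses ks p → a + count p g R ≡ a
  +-count-missed p g []      a []           _      = +-identityʳ a
  +-count-missed p g (e ∷ R) a (e∈ks ∷ cov) misses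
    rewrite Equivalence.to T-not-≡ (All.lookup misses e∈ks) = +-count-missed p g R a cov misses

  viable : ∀ B ks t R → Covered ks R → Completes t R → Viable B ks t
  viable B ks t R cov (pairs , points) =
      All.map (λ {(x , y)} x≢y →
                   subst (pairsOf t x y ≤_) (pairs x y x≢y) (m≤m+n _ _)
                 , λ misses → trans (sym (+-count-missed (pairIn x y) (λ _ → 1) R _ cov misses)) (pairs x y x≢y))
              (edges-distinct B)
    , All.universal (λ x misses → subst (3 ∣_) (+-count-missed (x ∈ᵇ_) proj₂ R _ cov misses) (points x))
                    (corners B)

  search-complete : ∀ ks t R → Covered ks R → All ResidueWeight R → Completes t R → search ks t ≡ true
  search-complete []       t []      []       _       _    = refl
  search-complete []       t (_ ∷ _) (() ∷ _) _       _
  search-complete (B ∷ ks) t R       cov      weights comp =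
    Equivalence.to T-≡ (any⁺ (tryCopies (search ks) B ks t)
      (lose (∈-options (multiplicity≤2 B R t comp) n≤w w≤2n)
            (Equivalence.from (T-∧ {⌊ viable? B ks t′ ⌋})
              ( fromWitness (viable B ks t′ N cov′ comp′)
              , Equivalence.from T-≡ (search-complete ks t′ N cov′ weights′ comp′)))))
    where
    N = othersThan B R
    t′ = addCopies B (multiplicity B R) (weightOfCopies B R) t
    comp′ = completes-othersThan B R t comp
    cov′ = covered-othersThan R cov
    weights′ = filter⁺ (λ e → ¬? (proj₁ e ≟ᵇ B)) weights
    n≤w = proj₁ (weight-bounds (copiesOf B R) (filter⁺ (λ e → proj₁ e ≟ᵇ B) weights))
    w≤2n = proj₂ (weight-bounds (copiesOf B R) (filter⁺ (λ e → proj₁ e ≟ᵇ B) weights))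

module _ {v : ℕ} (ℬ : List (Block v)) (f : Fin (length ℬ) → ℤ) where

  residueBlock : Fin (length ℬ) → WBlock v
  residueBlock i = lookup ℬ i , f i %ℕ 3

  residueBlocks : List (WBlock v)
  residueBlocks = tabulate residueBlock

  flowAt : Fin v → List ℤ
  flowAt x = map (λ i → if x ∈ᵇ lookup ℬ i then f i else 0ℤ) (allFin (length ℬ))

  count-pairs-residueBlocks : ∀ x y → count (pairIn x y) (λ _ → 1) residueBlocks ≡ pairCount x y ℬ
  count-pairs-residueBlocks x y = begin
    count (pairIn x y) (λ _ → 1) residueBlocks ≡⟨ cong sum (map-∘ residueBlocks) ⟩
    pairCount x y (map proj₁ residueBlocks)    ≡⟨ cong (pairCount x y) (map-tabulate residueBlock proj₁) ⟩
    pairCount x y (tabulate (lookup ℬ))        ≡⟨ cong (pairCount x y) (tabulate-lookup ℬ) ⟩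
    pairCount x y ℬ                            ∎
    where open ≡-Reasoning

  count-weights-residueBlocks : ∀ x → count (x ∈ᵇ_) proj₂ residueBlocks ≡ sum (map (_%ℕ 3) (flowAt x))
  count-weights-residueBlocks x = cong sum (begin
    map _ residueBlocks                                ≡⟨ map-tabulate _ _ ⟩
    tabulate (λ i → if x ∈ᵇ lookup ℬ i then f i %ℕ 3 else 0)
      ≡⟨ tabulate-cong (λ i → sym (if-float (_%ℕ 3) (x ∈ᵇ lookup ℬ i))) ⟩
    tabulate (λ i → valueAt i %ℕ 3)                    ≡⟨ sym (map-tabulate valueAt (_%ℕ 3)) ⟩
    map (_%ℕ 3) (tabulate valueAt)                     ≡⟨ cong (map (_%ℕ 3)) (sym (map-tabulate id valueAt)) ⟩
    map (_%ℕ 3) (flowAt x)                             ∎)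
    where
    open ≡-Reasoning
    valueAt : Fin (length ℬ) → ℤ
    valueAt i = if x ∈ᵇ lookup ℬ i then f i else 0ℤ

  completes-residueBlocks : IsTS v 2 ℬ → IsZeroSumFlow 3 ℬ f → Completes emptyTally residueBlocks
  completes-residueBlocks ts (_ , zero-sum) =
      (λ x y x≢y → trans (cong₂ _+_ (pairsOf-empty x y) (count-pairs-residueBlocks x y)) (ts x y x≢y))
    , (λ x → subst (3 ∣_) (sym (trans (cong (_+ count (x ∈ᵇ_) proj₂ residueBlocks) (weightOf-empty x))
                                       (count-weights-residueBlocks x)))
                          (zero-sum⇒∣sum-%ℕ 3 (flowAt x) (zero-sum x)))

  residueWeights : IsZeroSumFlow 3 ℬ f → All ResidueWeight residueBlocks
  residueWeights (bounded , _) = tabulate⁺ (λ i → %ℕ3-bounds (f i) (proj₁ (bounded i)) (proj₂ (bounded i)))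

  covered-residueBlocks : Covered (allBlocks v) residueBlocks
  covered-residueBlocks = All.universal (λ e → ∈-allBlocks (proj₁ e)) residueBlocks

search-fails : search (allBlocks 6) emptyTally ≡ false
search-fails = refl

no-TS[6,2]-with-3-flow : ¬ (∃ λ (ℬ : List (Block 6)) → IsTS 6 2 ℬ × HasZeroSumFlow 3 ℬ)
no-TS[6,2]-with-3-flow (ℬ , ts , f , flow) =
  case trans (sym search-fails) (search-complete (allBlocks 6) emptyTally (residueBlocks ℬ f)
         (covered-residueBlocks ℬ f) (residueWeights ℬ f flow) (completes-residueBlocks ℬ f ts flow))
  of λ ()

isTS? : ∀ v λ′ ℬ → Dec (IsTS v λ′ ℬ)
isTS? v λ′ ℬ = all? λ x → all? λ y → ¬? (x ≟ y) →-dec pairCount x y ℬ ≟ℕ λ′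

isZeroSumFlow? : ∀ {v} n ℬ f → Dec (IsZeroSumFlow {v} n ℬ f)
isZeroSumFlow? n ℬ f =
        all? (λ i → (0 <? ∣ f i ∣) ×-dec (∣ f i ∣ <? n))
  ×-dec all? (λ x → sumℤ (λ i → if x ∈ᵇ lookup ℬ i then f i else 0ℤ) ≟ᶻ 0ℤ)

block : (a b c : Fin 6) → {True (a <ᶠ? b)} → {True (b <ᶠ? c)} → Block 6
block a b c {a<b} {b<c} = (a , b , c) , toWitness a<b , toWitness b<c

design₁₀ : List (Block 6)
design₁₀ = block (# 0) (# 1) (# 4) ∷ block (# 0) (# 1) (# 5) ∷ block (# 0) (# 2) (# 3) ∷ block (# 0) (# 2) (# 5)
         ∷ block (# 0) (# 3) (# 4) ∷ block (# 1) (# 2) (# 3) ∷ block (# 1) (# 2) (# 4) ∷ block (# 1) (# 3) (# 5)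
         ∷ block (# 2) (# 4) (# 5) ∷ block (# 3) (# 4) (# 5) ∷ []

TS[6,2]-with-4-flow : ∃ λ (ℬ : List (Block 6)) → IsTS 6 2 ℬ × HasZeroSumFlow 4 ℬ
TS[6,2]-with-4-flow =
  design₁₀ , from-yes (isTS? 6 2 design₁₀) , lookup flow , from-yes (isZeroSumFlow? 4 design₁₀ (lookup flow))
  where
  flow : List ℤ
  flow = + 1 ∷ + 2 ∷ + 1 ∷ -[1+ 1 ] ∷ -[1+ 1 ] ∷ + 2 ∷ -[1+ 1 ] ∷ -[1+ 2 ] ∷ + 1 ∷ + 2 ∷ []

TS[6,4]-with-2-flow : ∃ λ (ℬ : List (Block 6)) → IsTS 6 4 ℬ × HasZeroSumFlow 2 ℬ
TS[6,4]-with-2-flow = ℬ , from-yes (isTS? 6 4 ℬ) , lookup flow , from-yes (isZeroSumFlow? 2 ℬ (lookup flow))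
  where
  ℬ : List (Block 6)
  ℬ = design₁₀ ++ design₁₀
  flow : List ℤ
  flow = replicate 10 (+ 1) ++ replicate 10 -[1+ 0 ]

TS[6,6]-with-3-flow : ∃ λ (ℬ : List (Block 6)) → IsTS 6 6 ℬ × HasZeroSumFlow 3 ℬ
TS[6,6]-with-3-flow = ℬ , from-yes (isTS? 6 6 ℬ) , lookup flow , from-yes (isZeroSumFlow? 3 ℬ (lookup flow))
  where
  ℬ : List (Block 6)
  ℬ = design₁₀ ++ design₁₀ ++ design₁₀
  flow : List ℤ
  flow = replicate 10 (+ 1) ++ replicate 10 (+ 1) ++ replicate 10 -[1+ 1 ]

mainTheorem12 :
    (¬ (∃ λ (ℬ : List (Block 6)) → IsTS 6 2 ℬ × HasZeroSumFlow 3 ℬ))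
    × (∃ λ (ℬ : List (Block 6)) → IsTS 6 2 ℬ × HasZeroSumFlow 4 ℬ)
    × (∃ λ (ℬ : List (Block 6)) → IsTS 6 4 ℬ × HasZeroSumFlow 2 ℬ)
    × (∃ λ (ℬ : List (Block 6)) → IsTS 6 6 ℬ × HasZeroSumFlow 3 ℬ)
mainTheorem12 = no-TS[6,2]-with-3-flow , TS[6,2]-with-4-flow , TS[6,4]-with-2-flow , TS[6,6]-with-3-flow
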